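{- Let $D=(V,A)$ be a directed acyclic graph, $s,t\in V$, $E := V\cup A$, and $\mathcal{P}\subseteq 2^E$ the set of $s$-$t$-paths in $D$ (each identified with the set of its nodes and arcs). Let $\pi \in [0,1]^{\mathcal{P}}$ satisfy $\pi_P + \pi_Q = \pi_{P \times_e Q} + \pi_{Q \times_e P}$ for all $P,Q\in\mathcal{P}$ and $e \in P\cap Q$. For $y \in \mathbb{R}^{\mathcal{P}}$ define $\bar\pi(y) := \sum_{P \in \mathcal{P}} (1 - \pi_P) y_P$ and $y_e := \sum_{P \in \mathcal{P}: e \in P} y_P$ for $e \in E$. Let $z, z' \in \mathbb{R}_+^{\mathcal{P}}$ with $z_e \ge z'_e$ for all $e \in E$. Then $\bar\pi(z) \ge \bar\pi(z')$.
   Context: For $P, Q \in \mathcal{P}$ and $e \in P\cap Q$, $P \times_e Q$ denotes the $s$-$t$-path consisting of the nodes and arcs of $P$ from $s$ up to and including $e$ followed by the nodes and arcs of $Q$ from $e$ to $t$. -}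

module Defs where

open import Level using (Level; _⊔_) renaming (suc to lsuc)
open import Data.Nat using (ℕ)
open import Data.Fin using (Fin)
open import Data.Sum using (_⊎_; inj₁; inj₂)
open import Data.Product using (Σ; ∃; _×_; _,_)
open import Data.Empty using (⊥)
open import Data.Unit using (⊤)
open import Data.Fin as Fin using ()
open import Data.Sum.Properties using (≡-dec)
open import Data.List.Membership.Propositional using (_∈_)
open import Data.List.Membership.DecPropositional using (_∈?_)
open import Relation.Nullary using (Dec)
open import Data.List using (List; []; _∷_; foldr; map; filter)
open import Relation.Binary.PropositionalEquality using (_≡_)
open import Relation.Nullary using (¬_)
open import Algebra.Bundles using (CommutativeRing)
open import Relation.Binary.Structures using (IsTotalOrder)

-- Ordered fields (stand-in for ℝ; ℝ is an instance).

record OrderedField (c ℓ : Level) : Set (lsuc (c ⊔ ℓ)) where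
  field
    commutativeRing : CommutativeRing c ℓ
  open CommutativeRing commutativeRing public
  field
    _≤_         : Carrier → Carrier → Set ℓ
    isTotalOrder : IsTotalOrder _≈_ _≤_
    +-mono-≤    : ∀ {x y} z → x ≤ y → (x + z) ≤ (y + z)
    *-nonneg    : ∀ {x y} → 0# ≤ x → 0# ≤ y → 0# ≤ (x * y)
    0≉1         : ¬ (0# ≈ 1#)
    inverse     : ∀ x → ¬ (x ≈ 0#) → Σ Carrier λ y → (x * y) ≈ 1#

  _≥_ : Carrier → Carrier → Set ℓ
  x ≥ y = y ≤ x

  Σ[_]_ : ∀ {a} {X : Set a} → List X → (X → Carrier) → Carrier
  Σ[ xs ] f = foldr (λ x acc → f x + acc) 0# xs

record Digraph : Set where
  field
    n m  : ℕ
    tail : Fin m → Fin n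
    head : Fin m → Fin n

module _ (D : Digraph) where
  open Digraph D

  Node : Set
  Node = Fin n

  Arc : Set
  Arc = Fin m

  Elem : Set
  Elem = Node ⊎ Arc

  data Walk : Node → Node → Set where
    []  : ∀ {v} → Walk v v
    _∷_ : ∀ {w} (a : Arc) → Walk (head a) w → Walk (tail a) w

  _++ʷ_ : ∀ {u v w} → Walk u v → Walk v w → Walk u w
  [] ++ʷ q = q
  (a ∷ p) ++ʷ q = a ∷ (p ++ʷ q)

  elems : ∀ {u w} → Walk u w → List Elem
  elems {u} [] = inj₁ u ∷ []
  elems (a ∷ p) = inj₁ (tail a) ∷ inj₂ a ∷ elems p

  _∈ʷ_ : ∀ {u w} → Elem → Walk u w → Set
  e ∈ʷ p = e ∈ elems p

  _∈ʷ?_ : ∀ {u w} (e : Elem) (p : Walk u w) → Dec (e ∈ʷ p)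
  e ∈ʷ? p = _∈?_ (≡-dec Fin._≟_ Fin._≟_) e (elems p)

  Acyclic : Set
  Acyclic = ∀ {v} (a : Arc) (p : Walk (head a) v) → tail a ≡ v → ⊥

  -- the node at which a walk is cut "up to and including e"
  cutNode : Elem → Node
  cutNode (inj₁ v) = v
  cutNode (inj₂ a) = head a

  -- the prefix ends with e (for a node: trivially, by its index;
  -- for an arc a: its last arc is a)
  EndsWith : ∀ {s} (e : Elem) → Walk s (cutNode e) → Set
  EndsWith (inj₁ v) pre = ⊤
  EndsWith {s} (inj₂ a) pre = Σ (Walk s (tail a)) λ pre′ → pre ≡ pre′ ++ʷ (a ∷ [])

  record Cut {s t : Node} (e : Elem) (P : Walk s t) : Set where
    constructor cut
    field
      pre   : Walk s (cutNode e)
      post  : Walk (cutNode e) t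
      split : pre ++ʷ post ≡ P
      ends  : EndsWith e pre

  -- P ×_e Q, given the (unique, in a DAG) cuts of P and Q at e
  cross : ∀ {s t} {e : Elem} {P Q : Walk s t} → Cut e P → Cut e Q → Walk s t
  cross cP cQ = Cut.pre cP ++ʷ Cut.post cQ

-- π̄(y) and y_e, for a fixed list Ps enumerating the s-t-paths

module _ {c ℓ} (F : OrderedField c ℓ) (D : Digraph) {s t : Node D}
         (Ps : List (Walk D s t)) where
  open OrderedField F

  πbar : (Walk D s t → Carrier) → (Walk D s t → Carrier) → Carrier
  πbar π y = Σ[ Ps ] (λ P → (1# - π P) * y P)

  yElem : (Walk D s t → Carrier) → Elem D → Carrier
  yElem y e = Σ[ filter (λ P → _∈ʷ?_ D e P) Ps ] y

-- Put w P := 1 − π P. The exchange property says that swapping the tails of two s-t-paths at a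
-- common node preserves their total weight. Let μ e be the least weight of an s-t-path through e.
-- In a DAG the exchange property makes w additive along paths,
--   w P = μ s + Σ_{a ∈ P} (μ a − μ (tail a)),
-- with nonnegative arc costs μ a − μ (tail a): by two exchanges a cheapest path through an arc a
-- joins a cheapest path through tail a (up to tail a) to one through head a (from head a), and a
-- third exchange shows that extending any prefix by a adds exactly μ a − μ (tail a).
-- Summing against y gives
--   π̄ y = μ s · y_s + Σ_a (μ a − μ (tail a)) · y_a,
-- a combination of the y_e with nonnegative coefficients, hence monotone in them.
module Submission where

open import Defs
open import Data.Product using (_×_)
open import Data.List using (List)
open import Data.List.Membership.Propositional using (_∈_)
open import Data.List.Relation.Unary.Unique.Propositional using (Unique)

open import Data.Nat using (zero; suc)
open import Data.Fin using (Fin; zero; suc; _≟_; punchIn)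
open import Data.Fin.Properties using (punchInᵢ≢i)
open import Data.List using ([]; _∷_; filter; map; length; lookup)
open import Data.List.Properties using (filter-all)
open import Data.List.Membership.Propositional.Properties using (∈-map⁺; ∈-map⁻; ∈-filter⁺; ∈-filter⁻)
open import Data.List.Relation.Unary.Any using (here; there)
import Data.List.Relation.Unary.All as All
import Data.List.Extrema
open import Data.Product using (Σ; _,_; proj₁; proj₂)
open import Data.Sum using (_⊎_; inj₁; inj₂)
open import Data.Unit using (tt)
open import Data.Vec.Functional using (removeAt)
open import Function using (_∘_; id)
open import Relation.Nullary using (Dec; yes; no; ¬_; contradiction)
open import Relation.Unary using (Pred; Decidable)
open import Relation.Binary.Bundles using (TotalOrder)
open import Relation.Binary.Structures using (IsTotalOrder)
open import Relation.Binary.PropositionalEquality as ≡ using (_≡_)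
import Relation.Binary.Reasoning.PartialOrder
import Algebra.Properties.AbelianGroup as AbelianGroupProperties
import Algebra.Properties.Group as GroupProperties
import Algebra.Properties.Ring as RingProperties
import Algebra.Properties.Semiring.Sum as SemiringSum
import Algebra.Solver.CommutativeMonoid as CommutativeMonoidSolver

module OrderedFieldProperties {c ℓ} (F : OrderedField c ℓ) where
  open OrderedField F public hiding (zero) renaming (_≤_ to infix 4 _≤_)
  open IsTotalOrder isTotalOrder public using (total; antisym)
    renaming (refl to ≤-refl; trans to ≤-trans; reflexive to ≤-reflexive)
  open GroupProperties +-group using (//-rightDividesˡ; //-rightDividesʳ; ⁻¹-involutive)
  open AbelianGroupProperties +-abelianGroup using (⁻¹-∙-comm)
  open RingProperties ring using (-1*x≈-x; x[y-z]≈xy-xz)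
  open CommutativeMonoidSolver +-commutativeMonoid using (solve; _⊕_; _⊜_)
  open import Relation.Binary.Reasoning.Setoid setoid

  totalOrder : TotalOrder c ℓ ℓ
  totalOrder = record { isTotalOrder = isTotalOrder }

  ≤-respˡʳ-≈ : ∀ {x y u v} → x ≈ u → y ≈ v → x ≤ y → u ≤ v
  ≤-respˡʳ-≈ x≈u y≈v x≤y = ≤-trans (≤-reflexive (sym x≈u)) (≤-trans x≤y (≤-reflexive y≈v))

  +-monoʳ-≤ : ∀ z {x y} → x ≤ y → z + x ≤ z + y
  +-monoʳ-≤ z {x} {y} x≤y = ≤-respˡʳ-≈ (+-comm x z) (+-comm y z) (+-mono-≤ z x≤y)

  +-mono₂-≤ : ∀ {x y u v} → x ≤ y → u ≤ v → x + u ≤ y + v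
  +-mono₂-≤ {y = y} {u} x≤y u≤v = ≤-trans (+-mono-≤ u x≤y) (+-monoʳ-≤ y u≤v)

  +-cancelʳ-≤ : ∀ z {x y} → x + z ≤ y + z → x ≤ y
  +-cancelʳ-≤ z {x} {y} le =
    ≤-respˡʳ-≈ (//-rightDividesʳ z x) (//-rightDividesʳ z y) (+-mono-≤ (- z) le)

  x+y≈z+w∧y≤w⇒z≤x : ∀ {x y z w} → x + y ≈ z + w → y ≤ w → z ≤ x
  x+y≈z+w∧y≤w⇒z≤x {z = z} eq y≤w = +-cancelʳ-≤ _ (≤-trans (+-monoʳ-≤ z y≤w) (≤-reflexive (sym eq)))

  x+u≈y+v⇒x≈y+[v-u] : ∀ {x y u v} → x + u ≈ y + v → x ≈ y + (v - u)
  x+u≈y+v⇒x≈y+[v-u] {x} {y} {u} {v} eq = begin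
    x               ≈⟨ //-rightDividesʳ u x ⟨
    (x + u) - u     ≈⟨ +-congʳ eq ⟩
    (y + v) - u     ≈⟨ +-assoc y v (- u) ⟩
    y + (v - u)     ∎

  x≤y⇒0≤y-x : ∀ {x y} → x ≤ y → 0# ≤ y - x
  x≤y⇒0≤y-x {x} x≤y = ≤-respˡʳ-≈ (-‿inverseʳ x) refl (+-mono-≤ (- x) x≤y)

  0≤y-x⇒x≤y : ∀ {x y} → 0# ≤ y - x → x ≤ y
  0≤y-x⇒x≤y {x} {y} 0≤y-x = ≤-respˡʳ-≈ (+-identityˡ x) (//-rightDividesˡ x y) (+-mono-≤ x 0≤y-x)

  *-monoʳ-≤-nonNeg : ∀ {a x y} → 0# ≤ a → x ≤ y → a * x ≤ a * y
  *-monoʳ-≤-nonNeg {a} {x} {y} 0≤a x≤y =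
    0≤y-x⇒x≤y (≤-respˡʳ-≈ refl (x[y-z]≈xy-xz a y x) (*-nonneg 0≤a (x≤y⇒0≤y-x x≤y)))

  0≤1 : 0# ≤ 1#
  0≤1 with total 0# 1#
  ... | inj₁ le    = le
  ... | inj₂ 1≤0 = ≤-respˡʳ-≈ refl [-1]*[-1]≈1 (*-nonneg 0≤-1 0≤-1)
    where
    0≤-1 : 0# ≤ - 1#
    0≤-1 = ≤-respˡʳ-≈ (-‿inverseʳ 1#) (+-identityˡ (- 1#)) (+-mono-≤ (- 1#) 1≤0)
    [-1]*[-1]≈1 : - 1# * - 1# ≈ 1#
    [-1]*[-1]≈1 = trans (-1*x≈-x (- 1#)) (⁻¹-involutive 1#)

  y-x≤y : ∀ {x y} → 0# ≤ x → y - x ≤ y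
  y-x≤y {x} {y} 0≤x = ≤-respˡʳ-≈ (+-identityʳ (y - x)) (//-rightDividesˡ x y) (+-monoʳ-≤ (y - x) 0≤x)

  [k-a]+[k-b]≈[k-x]+[k-y] : ∀ k {a b x y} → a + b ≈ x + y → (k - a) + (k - b) ≈ (k - x) + (k - y)
  [k-a]+[k-b]≈[k-x]+[k-y] k {a} {b} {x} {y} a+b≈x+y = begin
    (k - a) + (k - b)      ≈⟨ regroup a b ⟩
    (k + k) + (- a + - b)  ≈⟨ +-congˡ (trans (⁻¹-∙-comm a b) (-‿cong a+b≈x+y)) ⟩
    (k + k) - (x + y)      ≈⟨ +-congˡ (⁻¹-∙-comm x y) ⟨
    (k + k) + (- x + - y)  ≈⟨ regroup x y ⟨
    (k - x) + (k - y)      ∎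
    where
    regroup : ∀ u v → (k - u) + (k - v) ≈ (k + k) + (- u + - v)
    regroup u v = solve 3 (λ k u′ v′ → (k ⊕ u′) ⊕ (k ⊕ v′) ⊜ (k ⊕ k) ⊕ (u′ ⊕ v′)) refl k (- u) (- v)

module FiniteSums {c ℓ} (F : OrderedField c ℓ) where
  open OrderedFieldProperties F
  open SemiringSum semiring public
    using (sum; sum-replicate-zero; sum-cong-≋; ∑-distrib-+; ∑-comm; *-distribˡ-sum; *-distribʳ-sum)
  open SemiringSum semiring using (sum-remove)
  open import Relation.Binary.Reasoning.Setoid setoid

  𝟙 : ∀ {p} {A : Set p} → Dec A → Carrier
  𝟙 (yes _) = 1#
  𝟙 (no _)  = 0#

  𝟙-yes : ∀ {p} {A : Set p} (A? : Dec A) → A → 𝟙 A? ≈ 1#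
  𝟙-yes (yes _) _ = refl
  𝟙-yes (no ¬a) a = contradiction a ¬a

  𝟙-no : ∀ {p} {A : Set p} (A? : Dec A) → ¬ A → 𝟙 A? ≈ 0#
  𝟙-no (yes a) ¬a = contradiction a ¬a
  𝟙-no (no _)  _  = refl

  𝟙-resp-⇔ : ∀ {p q} {A : Set p} {B : Set q} (A? : Dec A) (B? : Dec B) →
             (A → B) → (B → A) → 𝟙 A? ≈ 𝟙 B?
  𝟙-resp-⇔ (yes _) (yes _) _   _   = refl
  𝟙-resp-⇔ (yes a) (no ¬b) A→B _   = contradiction (A→B a) ¬b
  𝟙-resp-⇔ (no ¬a) (yes b) _   B→A = contradiction (B→A b) ¬a
  𝟙-resp-⇔ (no _)  (no _)  _   _   = refl

  Σ≡sum∘lookup : ∀ {a} {X : Set a} (xs : List X) (f : X → Carrier) → Σ[ xs ] f ≡ sum (f ∘ lookup xs)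
  Σ≡sum∘lookup []       f = ≡.refl
  Σ≡sum∘lookup (x ∷ xs) f = ≡.cong (f x +_) (Σ≡sum∘lookup xs f)

  Σ-filter : ∀ {a p} {X : Set a} {P : Pred X p} (P? : Decidable P) (xs : List X) (f : X → Carrier) →
             Σ[ filter P? xs ] f ≈ Σ[ xs ] (λ x → 𝟙 (P? x) * f x)
  Σ-filter P? []       f = refl
  Σ-filter P? (x ∷ xs) f with P? x
  ... | yes _ = +-cong (sym (*-identityˡ (f x))) (Σ-filter P? xs f)
  ... | no _  = trans (Σ-filter P? xs f) (sym (trans (+-congʳ (zeroˡ (f x))) (+-identityˡ _)))

  sum-mono-≤ : ∀ {n} {f g : Fin n → Carrier} → (∀ i → f i ≤ g i) → sum f ≤ sum g
  sum-mono-≤ {zero}  f≤g = ≤-refl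
  sum-mono-≤ {suc n} f≤g = +-mono₂-≤ (f≤g zero) (sum-mono-≤ (f≤g ∘ suc))

  sum-δ : ∀ {n} (f : Fin n → Carrier) (b : Fin n) → sum (λ a → f a * 𝟙 (a ≟ b)) ≈ f b
  sum-δ {suc n} f b = begin
    sum g                      ≈⟨ sum-remove g ⟩
    g b + sum (removeAt g b)   ≈⟨ +-cong gb≈fb (trans (sum-cong-≋ g∘punchIn≈0) (sum-replicate-zero n)) ⟩
    f b + 0#                   ≈⟨ +-identityʳ (f b) ⟩
    f b                        ∎
    where
    g : Fin (suc n) → Carrier
    g a = f a * 𝟙 (a ≟ b)
    gb≈fb : g b ≈ f b
    gb≈fb = trans (*-congˡ (𝟙-yes (b ≟ b) ≡.refl)) (*-identityʳ (f b))
    g∘punchIn≈0 : ∀ i → g (punchIn b i) ≈ 0#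
    g∘punchIn≈0 i = trans (*-congˡ (𝟙-no (punchIn b i ≟ b) (punchInᵢ≢i b i))) (zeroʳ _)

module WalkProperties (D : Digraph) where
  open Digraph D using (tail; head)

  infixr 5 _++_
  _++_ : ∀ {u v w} → Walk D u v → Walk D v w → Walk D u w
  _++_ = _++ʷ_ D

  ++-assoc : ∀ {u v w x} (p : Walk D u v) (q : Walk D v w) (r : Walk D w x) →
             (p ++ q) ++ r ≡ p ++ (q ++ r)
  ++-assoc []      q r = ≡.refl
  ++-assoc (a ∷ p) q r = ≡.cong (a ∷_) (++-assoc p q r)

  node∈++ : ∀ {x u y} (p : Walk D x u) (q : Walk D u y) → inj₁ u ∈ elems D (p ++ q)
  node∈++ []      []      = here ≡.refl
  node∈++ []      (a ∷ q) = here ≡.refl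
  node∈++ (a ∷ p) q       = there (there (node∈++ p q))

  arc∈++∷ : ∀ {x y b} (p : Walk D x (tail b)) (r : Walk D (head b) y) →
            inj₂ b ∈ elems D (p ++ b ∷ r)
  arc∈++∷ []      r = there (here ≡.refl)
  arc∈++∷ (a ∷ p) r = there (there (arc∈++∷ p r))

  split-at-node : ∀ {x y u} (Q : Walk D x y) → inj₁ u ∈ elems D Q →
                  Σ (Walk D x u) λ p → Σ (Walk D u y) λ q → p ++ q ≡ Q
  split-at-node []      (here ≡.refl)         = [] , [] , ≡.refl
  split-at-node (a ∷ Q) (here ≡.refl)         = [] , a ∷ Q , ≡.refl
  split-at-node (a ∷ Q) (there (there u∈Q)) with split-at-node Q u∈Q
  ... | p , q , p++q≡Q = a ∷ p , q , ≡.cong (a ∷_) p++q≡Q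

  split-at-arc : ∀ {x y b} (Q : Walk D x y) → inj₂ b ∈ elems D Q →
                 Σ (Walk D x (tail b)) λ p → Σ (Walk D (head b) y) λ r → p ++ b ∷ r ≡ Q
  split-at-arc []      (here ())
  split-at-arc []      (there ())
  split-at-arc (a ∷ Q) (there (here ≡.refl))  = [] , Q , ≡.refl
  split-at-arc (a ∷ Q) (there (there b∈Q)) with split-at-arc Q b∈Q
  ... | p , r , p++b∷r≡Q = a ∷ p , r , ≡.cong (a ∷_) p++b∷r≡Q

  module _ (acyclic : Acyclic D) where

    closed-walk≡[] : ∀ {v} (p : Walk D v v) → p ≡ []
    closed-walk≡[] []      = ≡.refl
    closed-walk≡[] (a ∷ p) = contradiction ≡.refl (acyclic a p)

    arc∉walk-from-head : ∀ {y b} (p : Walk D (head b) y) → ¬ (inj₂ b ∈ elems D p)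
    arc∉walk-from-head p b∈p with split-at-arc p b∈p
    ... | q , _ , _ = acyclic _ q ≡.refl

module ArcSums {c ℓ} (F : OrderedField c ℓ) (D : Digraph) (acyclic : Acyclic D) where
  open OrderedFieldProperties F
  open FiniteSums F
  open WalkProperties D
  open Digraph D using (m; tail; head)
  open import Relation.Binary.Reasoning.Setoid setoid

  arcSum : ∀ {x y} → (Arc D → Carrier) → Walk D x y → Carrier
  arcSum κ []      = 0#
  arcSum κ (a ∷ p) = κ a + arcSum κ p

  𝟙[_∈_] : ∀ {x y} → Arc D → Walk D x y → Carrier
  𝟙[ a ∈ p ] = 𝟙 (_∈ʷ?_ D (inj₂ a) p)

  𝟙[∈∷] : ∀ {y} a b (p : Walk D (head b) y) → 𝟙[ a ∈ b ∷ p ] ≈ 𝟙 (a ≟ b) + 𝟙[ a ∈ p ]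
  𝟙[∈∷] a b p = split (a ≟ b)
    where
    split : (a≟b : Dec (a ≡ b)) → 𝟙[ a ∈ b ∷ p ] ≈ 𝟙 a≟b + 𝟙[ a ∈ p ]
    split (yes ≡.refl) = begin
      𝟙[ a ∈ a ∷ p ]  ≈⟨ 𝟙-yes (_∈ʷ?_ D (inj₂ a) (a ∷ p)) (there (here ≡.refl)) ⟩
      1#               ≈⟨ +-identityʳ 1# ⟨
      1# + 0#          ≈⟨ +-congˡ (𝟙-no (_∈ʷ?_ D (inj₂ a) p) (arc∉walk-from-head acyclic p)) ⟨
      1# + 𝟙[ a ∈ p ]  ∎
    split (no a≢b) = begin
      𝟙[ a ∈ b ∷ p ]   ≈⟨ 𝟙-resp-⇔ (_∈ʷ?_ D (inj₂ a) (b ∷ p)) (_∈ʷ?_ D (inj₂ a) p) drop-∷ (there ∘ there) ⟩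
      𝟙[ a ∈ p ]       ≈⟨ +-identityˡ _ ⟨
      0# + 𝟙[ a ∈ p ]  ∎
      where
      drop-∷ : inj₂ a ∈ elems D (b ∷ p) → inj₂ a ∈ elems D p
      drop-∷ (there (here ≡.refl)) = contradiction ≡.refl a≢b
      drop-∷ (there (there a∈p))   = a∈p

  arcSum≈sum𝟙 : ∀ {x y} (κ : Arc D → Carrier) (p : Walk D x y) →
                arcSum κ p ≈ sum (λ a → κ a * 𝟙[ a ∈ p ])
  arcSum≈sum𝟙 {x} κ [] = sym (trans (sum-cong-≋ κ*0≈0) (sum-replicate-zero m))
    where
    κ*0≈0 : ∀ a → κ a * 𝟙[ a ∈ [] {v = x} ] ≈ 0#
    κ*0≈0 a = trans (*-congˡ (𝟙-no (_∈ʷ?_ D (inj₂ a) ([] {v = x})) λ { (here ()) ; (there ()) }))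
                    (zeroʳ (κ a))
  arcSum≈sum𝟙 κ (b ∷ p) = sym (begin
    sum (λ a → κ a * 𝟙[ a ∈ b ∷ p ])
      ≈⟨ sum-cong-≋ (λ a → trans (*-congˡ (𝟙[∈∷] a b p)) (distribˡ (κ a) _ _)) ⟩
    sum (λ a → κ a * 𝟙 (a ≟ b) + κ a * 𝟙[ a ∈ p ])
      ≈⟨ ∑-distrib-+ (λ a → κ a * 𝟙 (a ≟ b)) (λ a → κ a * 𝟙[ a ∈ p ]) ⟩
    sum (λ a → κ a * 𝟙 (a ≟ b)) + sum (λ a → κ a * 𝟙[ a ∈ p ])
      ≈⟨ +-cong (sum-δ κ b) (sym (arcSum≈sum𝟙 κ p)) ⟩
    κ b + arcSum κ p ∎)

module Potential {c ℓ} (F : OrderedField c ℓ) (D : Digraph) (acyclic : Acyclic D) {s t : Node D}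
                 (Ps : List (Walk D s t)) (complete : ∀ P → P ∈ Ps) where
  open OrderedFieldProperties F
  open FiniteSums F
  open WalkProperties D
  open ArcSums F D acyclic
  open Digraph D using (tail; head)
  open Data.List.Extrema totalOrder using (min; min≤⊤; min≤xs; argmin-sel)

  module _ (w : Walk D s t → Carrier)
           (w∈[0,1] : ∀ P → 0# ≤ w P × w P ≤ 1#)
           (w-exchange : ∀ {u} (p p′ : Walk D s u) (q q′ : Walk D u t) →
                         w (p ++ q) + w (p′ ++ q′) ≈ w (p ++ q′) + w (p′ ++ q)) where

    suffix-comparison : ∀ {u} (p p′ : Walk D s u) (q q′ : Walk D u t) →
                        w (p′ ++ q′) ≤ w (p′ ++ q) → w (p ++ q′) ≤ w (p ++ q)
    suffix-comparison p p′ q q′ = x+y≈z+w∧y≤w⇒z≤x (w-exchange p p′ q q′)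

    prefix-comparison : ∀ {u} (p p′ : Walk D s u) (q q′ : Walk D u t) →
                        w (p′ ++ q′) ≤ w (p ++ q′) → w (p′ ++ q) ≤ w (p ++ q)
    prefix-comparison p p′ q q′ = x+y≈z+w∧y≤w⇒z≤x (trans (w-exchange p p′ q q′) (+-comm _ _))

    through : Elem D → List (Walk D s t)
    through e = filter (_∈ʷ?_ D e) Ps

    -- The default 1 when no path passes through e never undercuts a path, as w ≤ 1.
    μ : Elem D → Carrier
    μ e = min 1# (map w (through e))

    μ≤w : ∀ {e} Q → e ∈ elems D Q → μ e ≤ w Q
    μ≤w {e} Q e∈Q = All.lookup (min≤xs 1# (map w (through e)))
                               (∈-map⁺ w (∈-filter⁺ (_∈ʷ?_ D e) (complete Q) e∈Q))

    μ≤1 : ∀ e → μ e ≤ 1#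
    μ≤1 e = min≤⊤ 1# (map w (through e))

    μ-sel : ∀ e → μ e ≡ 1# ⊎ Σ (Walk D s t) λ Q → e ∈ elems D Q × μ e ≡ w Q
    μ-sel e with argmin-sel id 1# (map w (through e))
    ... | inj₁ μ≡1  = inj₁ μ≡1
    ... | inj₂ μ∈ws with ∈-map⁻ w μ∈ws
    ...   | Q , Q∈through , μ≡wQ = inj₂ (Q , proj₂ (∈-filter⁻ (_∈ʷ?_ D e) {xs = Ps} Q∈through) , μ≡wQ)

    0≤μ : ∀ e → 0# ≤ μ e
    0≤μ e with μ-sel e
    ... | inj₁ μ≡1          = ≤-respˡʳ-≈ refl (reflexive (≡.sym μ≡1)) 0≤1
    ... | inj₂ (Q , _ , μ≡wQ) = ≤-respˡʳ-≈ refl (reflexive (≡.sym μ≡wQ)) (proj₁ (w∈[0,1] Q))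

    μ-attained : ∀ {e} Q₀ → e ∈ elems D Q₀ → Σ (Walk D s t) λ Q → e ∈ elems D Q × w Q ≈ μ e
    μ-attained {e} Q₀ e∈Q₀ with μ-sel e
    ... | inj₁ μ≡1 =
      Q₀ , e∈Q₀ , antisym (≤-respˡʳ-≈ refl (reflexive (≡.sym μ≡1)) (proj₂ (w∈[0,1] Q₀))) (μ≤w Q₀ e∈Q₀)
    ... | inj₂ (Q , e∈Q , μ≡wQ) = Q , e∈Q , reflexive (≡.sym μ≡wQ)

    record NodeMinimizer (u : Node D) : Set ℓ where
      field
        pre     : Walk D s u
        post    : Walk D u t
        optimal : w (pre ++ post) ≈ μ (inj₁ u)

    record ArcMinimizer (b : Arc D) : Set ℓ where
      field
        pre     : Walk D s (tail b)
        post    : Walk D (head b) t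
        optimal : w (pre ++ b ∷ post) ≈ μ (inj₂ b)

    nodeMinimizer : ∀ {u} Q₀ → inj₁ u ∈ elems D Q₀ → NodeMinimizer u
    nodeMinimizer Q₀ u∈Q₀ with μ-attained Q₀ u∈Q₀
    ... | Q , u∈Q , wQ≈μ with split-at-node Q u∈Q
    ...   | p , q , ≡.refl = record { pre = p ; post = q ; optimal = wQ≈μ }

    arcMinimizer : ∀ {b} Q₀ → inj₂ b ∈ elems D Q₀ → ArcMinimizer b
    arcMinimizer Q₀ b∈Q₀ with μ-attained Q₀ b∈Q₀
    ... | Q , b∈Q , wQ≈μ with split-at-arc Q b∈Q
    ...   | p , r , ≡.refl = record { pre = p ; post = r ; optimal = wQ≈μ }

    cost : Arc D → Carrier
    cost b = μ (inj₂ b) - μ (inj₁ (tail b))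

    0≤cost : ∀ b → 0# ≤ cost b
    0≤cost b = x≤y⇒0≤y-x μtail≤μb
      where
      μtail≤μb : μ (inj₁ (tail b)) ≤ μ (inj₂ b)
      μtail≤μb with μ-sel (inj₂ b)
      ... | inj₁ μ≡1 = ≤-respˡʳ-≈ refl (reflexive (≡.sym μ≡1)) (μ≤1 _)
      ... | inj₂ (Q , b∈Q , _) =
        let open ArcMinimizer (arcMinimizer Q b∈Q)
        in ≤-trans (μ≤w (pre ++ b ∷ post) (node∈++ pre (b ∷ post))) (≤-reflexive optimal)

    nodeMinimizer-≤ : ∀ {u} (N : NodeMinimizer u) (p : Walk D s u) (q : Walk D u t) →
                      w (NodeMinimizer.pre N ++ NodeMinimizer.post N) ≤ w (p ++ q)
    nodeMinimizer-≤ N p q = ≤-trans (≤-reflexive (NodeMinimizer.optimal N)) (μ≤w (p ++ q) (node∈++ p q))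

    module _ {b : Arc D} (Nu : NodeMinimizer (tail b)) (Nv : NodeMinimizer (head b)) where
      open NodeMinimizer Nu renaming (pre to pu; post to ru; optimal to optimalᵤ)
      open NodeMinimizer Nv renaming (pre to pv; post to rv; optimal to optimalᵥ)

      arc-minimum : ArcMinimizer b → w (pu ++ b ∷ rv) ≈ μ (inj₂ b)
      arc-minimum Ab = antisym w≤μ (μ≤w (pu ++ b ∷ rv) (arc∈++∷ pu rv))
        where
        open ArcMinimizer Ab renaming (pre to pb; post to rb; optimal to optimalₐ)
        open Relation.Binary.Reasoning.PartialOrder (TotalOrder.poset totalOrder)
        w≤μ : w (pu ++ b ∷ rv) ≤ μ (inj₂ b)
        w≤μ = begin
          w (pu ++ b ∷ rv)          ≤⟨ prefix-comparison pb pu (b ∷ rv) ru (nodeMinimizer-≤ Nu pb ru) ⟩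
          w (pb ++ b ∷ rv)          ≡⟨ ≡.cong w (++-assoc pb (b ∷ []) rv) ⟨
          w ((pb ++ b ∷ []) ++ rv)  ≤⟨ suffix-comparison (pb ++ b ∷ []) pv rb rv (nodeMinimizer-≤ Nv pv rb) ⟩
          w ((pb ++ b ∷ []) ++ rb)  ≡⟨ ≡.cong w (++-assoc pb (b ∷ []) rb) ⟩
          w (pb ++ b ∷ rb)          ≈⟨ optimalₐ ⟩
          μ (inj₂ b)                ∎

      arc-step : ArcMinimizer b → ∀ p → w (p ++ b ∷ rv) ≈ w (p ++ ru) + cost b
      arc-step Ab p = x+u≈y+v⇒x≈y+[v-u] (begin
        w (p ++ b ∷ rv) + μ (inj₁ (tail b))  ≈⟨ +-congˡ optimalᵤ ⟨
        w (p ++ b ∷ rv) + w (pu ++ ru)       ≈⟨ w-exchange p pu (b ∷ rv) ru ⟩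
        w (p ++ ru) + w (pu ++ b ∷ rv)       ≈⟨ +-congˡ (arc-minimum Ab) ⟩
        w (p ++ ru) + μ (inj₂ b)             ∎)
        where open import Relation.Binary.Reasoning.Setoid setoid

    suffix-decomposition : ∀ {u} (N : NodeMinimizer u) (p : Walk D s u) (q : Walk D u t) →
                           w (p ++ q) ≈ w (p ++ NodeMinimizer.post N) + arcSum cost q
    suffix-decomposition N p [] rewrite closed-walk≡[] acyclic (NodeMinimizer.post N) = sym (+-identityʳ _)
    suffix-decomposition N p (b ∷ q) = begin
      w (p ++ b ∷ q)                           ≡⟨ ≡.cong w (++-assoc p (b ∷ []) q) ⟨
      w ((p ++ b ∷ []) ++ q)                   ≈⟨ suffix-decomposition Nv (p ++ b ∷ []) q ⟩
      w ((p ++ b ∷ []) ++ rv) + arcSum cost q  ≡⟨ ≡.cong (λ W → w W + arcSum cost q) (++-assoc p (b ∷ []) rv) ⟩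
      w (p ++ b ∷ rv) + arcSum cost q          ≈⟨ +-congʳ (arc-step N Nv Ab p) ⟩
      (w (p ++ ru) + cost b) + arcSum cost q   ≈⟨ +-assoc _ _ _ ⟩
      w (p ++ ru) + arcSum cost (b ∷ q)        ∎
      where
      open import Relation.Binary.Reasoning.Setoid setoid
      ru = NodeMinimizer.post N
      Nv : NodeMinimizer (head b)
      Nv = nodeMinimizer ((p ++ b ∷ []) ++ q) (node∈++ (p ++ b ∷ []) q)
      rv = NodeMinimizer.post Nv
      Ab : ArcMinimizer b
      Ab = arcMinimizer (p ++ b ∷ q) (arc∈++∷ p q)

    w≈μ+arcSum : ∀ P → w P ≈ μ (inj₁ s) + arcSum cost P
    w≈μ+arcSum P = trans (suffix-decomposition Ns [] P) (+-congʳ w[post]≈μ)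
      where
      Ns : NodeMinimizer s
      Ns = nodeMinimizer P (node∈++ [] P)
      open NodeMinimizer Ns
      w[post]≈μ : w post ≈ μ (inj₁ s)
      w[post]≈μ = ≡.subst (λ p → w (p ++ post) ≈ μ (inj₁ s)) (closed-walk≡[] acyclic pre) optimal

    module _ (y : Walk D s t → Carrier) where
      open import Relation.Binary.Reasoning.Setoid setoid

      ŷ : Elem D → Carrier
      ŷ = yElem F D Ps y

      ŷ≈sum𝟙 : ∀ e → ŷ e ≈ sum (λ i → 𝟙 (_∈ʷ?_ D e (lookup Ps i)) * y (lookup Ps i))
      ŷ≈sum𝟙 e = trans (Σ-filter (_∈ʷ?_ D e) Ps y) (reflexive (Σ≡sum∘lookup Ps _))

      ŷ[s]≡Σy : ŷ (inj₁ s) ≡ Σ[ Ps ] y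
      ŷ[s]≡Σy = ≡.cong (λ Qs → Σ[ Qs ] y)
                       (filter-all (_∈ʷ?_ D (inj₁ s)) {Ps} (All.tabulate λ {P} _ → node∈++ [] P))

      w*y-expansion : ∀ Q → w Q * y Q ≈ μ (inj₁ s) * y Q + sum (λ a → cost a * (𝟙[ a ∈ Q ] * y Q))
      w*y-expansion Q = begin
        w Q * y Q                                                ≈⟨ *-congʳ (w≈μ+arcSum Q) ⟩
        (μ (inj₁ s) + arcSum cost Q) * y Q                       ≈⟨ distribʳ (y Q) _ _ ⟩
        μ (inj₁ s) * y Q + arcSum cost Q * y Q                   ≈⟨ +-congˡ (*-congʳ (arcSum≈sum𝟙 cost Q)) ⟩
        μ (inj₁ s) * y Q + sum (λ a → cost a * 𝟙[ a ∈ Q ]) * y Q ≈⟨ +-congˡ (*-distribʳ-sum (y Q) λ a → cost a * 𝟙[ a ∈ Q ]) ⟩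
        μ (inj₁ s) * y Q + sum (λ a → cost a * 𝟙[ a ∈ Q ] * y Q) ≈⟨ +-congˡ (sum-cong-≋ λ a → *-assoc (cost a) _ _) ⟩
        μ (inj₁ s) * y Q + sum (λ a → cost a * (𝟙[ a ∈ Q ] * y Q)) ∎

      weighted-sum-expansion : Σ[ Ps ] (λ P → w P * y P) ≈
                               μ (inj₁ s) * ŷ (inj₁ s) + sum (λ a → cost a * ŷ (inj₂ a))
      weighted-sum-expansion = begin
        Σ[ Ps ] (λ P → w P * y P)
          ≡⟨ Σ≡sum∘lookup Ps _ ⟩
        sum (λ i → w (P i) * y (P i))
          ≈⟨ sum-cong-≋ (w*y-expansion ∘ P) ⟩
        sum (λ i → μ (inj₁ s) * y (P i) + sum (λ a → g i a))
          ≈⟨ ∑-distrib-+ (λ i → μ (inj₁ s) * y (P i)) _ ⟩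
        sum (λ i → μ (inj₁ s) * y (P i)) + sum (λ i → sum (λ a → g i a))
          ≈⟨ +-cong (sym (*-distribˡ-sum (μ (inj₁ s)) (y ∘ P))) (∑-comm g) ⟩
        μ (inj₁ s) * sum (y ∘ P) + sum (λ a → sum (λ i → g i a))
          ≈⟨ +-cong (*-congˡ source)
                    (sum-cong-≋ λ a → sym (*-distribˡ-sum (cost a) λ i → 𝟙[ a ∈ P i ] * y (P i))) ⟩
        μ (inj₁ s) * ŷ (inj₁ s) + sum (λ a → cost a * sum (λ i → 𝟙[ a ∈ P i ] * y (P i)))
          ≈⟨ +-congˡ (sum-cong-≋ λ a → *-congˡ (sym (ŷ≈sum𝟙 (inj₂ a)))) ⟩
        μ (inj₁ s) * ŷ (inj₁ s) + sum (λ a → cost a * ŷ (inj₂ a)) ∎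
        where
        P = lookup Ps
        g : Fin (length Ps) → Arc D → Carrier
        g i a = cost a * (𝟙[ a ∈ P i ] * y (P i))
        source : sum (y ∘ P) ≈ ŷ (inj₁ s)
        source = reflexive (≡.trans (≡.sym (Σ≡sum∘lookup Ps y)) (≡.sym ŷ[s]≡Σy))

    weighted-sum-mono : (y y′ : Walk D s t → Carrier) → (∀ e → yElem F D Ps y′ e ≤ yElem F D Ps y e) →
                        Σ[ Ps ] (λ P → w P * y′ P) ≤ Σ[ Ps ] (λ P → w P * y P)
    weighted-sum-mono y y′ y′≤y =
      ≤-respˡʳ-≈ (sym (weighted-sum-expansion y′)) (sym (weighted-sum-expansion y))
        (+-mono₂-≤ (*-monoʳ-≤-nonNeg (0≤μ (inj₁ s)) (y′≤y (inj₁ s)))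
                   (sum-mono-≤ λ a → *-monoʳ-≤-nonNeg (0≤cost a) (y′≤y (inj₂ a))))

lemma6 : ∀ {c ℓ} (F : OrderedField c ℓ) (D : Digraph) → Acyclic D →
         (s t : Node D) →
         (Ps : List (Walk D s t)) → Unique Ps → (∀ P → P ∈ Ps) →
         (π : Walk D s t → OrderedField.Carrier F) →
         (∀ P → OrderedField._≤_ F (OrderedField.0# F) (π P) × OrderedField._≤_ F (π P) (OrderedField.1# F)) →
         (∀ (P Q : Walk D s t) (e : Elem D) (cP : Cut D e P) (cQ : Cut D e Q) →
            OrderedField._≈_ F (OrderedField._+_ F (π P) (π Q))
              (OrderedField._+_ F (π (cross D cP cQ)) (π (cross D cQ cP)))) →
         (z z′ : Walk D s t → OrderedField.Carrier F) →
         (∀ P → OrderedField._≤_ F (OrderedField.0# F) (z P)) →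
         (∀ P → OrderedField._≤_ F (OrderedField.0# F) (z′ P)) →
         (∀ e → OrderedField._≥_ F (yElem F D Ps z e) (yElem F D Ps z′ e)) →
         OrderedField._≥_ F (πbar F D Ps π z) (πbar F D Ps π z′)
lemma6 F D acyclic s t Ps _ complete π π∈[0,1] π-exchange z z′ _ _ z′≤z =
  Potential.weighted-sum-mono F D acyclic Ps complete w w∈[0,1] w-exchange z z′ z′≤z
  where
  open OrderedFieldProperties F
  open WalkProperties D using (_++_)

  w : Walk D s t → Carrier
  w P = 1# - π P

  w∈[0,1] : ∀ P → 0# ≤ w P × w P ≤ 1#
  w∈[0,1] P = x≤y⇒0≤y-x (proj₂ (π∈[0,1] P)) , y-x≤y (proj₁ (π∈[0,1] P))

  w-exchange : ∀ {u} (p p′ : Walk D s u) (q q′ : Walk D u t) →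
               w (p ++ q) + w (p′ ++ q′) ≈ w (p ++ q′) + w (p′ ++ q)
  w-exchange p p′ q q′ = [k-a]+[k-b]≈[k-x]+[k-y] 1#
    (π-exchange (p ++ q) (p′ ++ q′) (inj₁ _) (cut p q ≡.refl tt) (cut p′ q′ ≡.refl tt))
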